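{- Let $v\ge 2$ and let $C$ be a uniform covering array $\mathrm{UCA}(v^2+v-1;v+2,v)$. For $0\le i\le v+2$ let $a_i$ be the number of rows of $C$ that contain exactly $i$ high frequency entries. If $a_0=1$, then $a_{v+1}=v^2+v-2$ and $a_i=0$ for all $i\notin\{0,v+1\}$.
   Context: A (strength-$2$) covering array $\mathrm{CA}(N;k,v)$ is an $N\times k$ array with entries from $\{0,1,\dots,v-1\}$ such that for every choice of two distinct columns $c,c'$ and every pair $(x,y)$ of symbols, there is at least one row with entry $x$ in column $c$ and entry $y$ in column $c'$. It is uniform, written $\mathrm{UCA}(N;k,v)$, if in every column every symbol occurs either $\lfloor N/v\rfloor$ or $\lceil N/v\rceil$ times. An entry of a $\mathrm{UCA}(N;k,v)$ is a high frequency entry if the symbol in that entry occurs at least $v+1$ times in the entry's column. -}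

module Defs where

open import Data.Nat using (ℕ; zero; suc; _+_; _*_; _∸_; _≤_; _≤?_; NonZero)
open import Data.Nat.Properties using (_≟_)
open import Data.Nat.DivMod using (_/_)
open import Data.Fin using (Fin)
import Data.Fin.Properties as FinP
open import Data.List using (List; length; filter)
open import Data.List.Base using (allFin)
open import Data.Product using (∃; _×_)
open import Data.Sum using (_⊎_)
open import Relation.Binary.PropositionalEquality using (_≡_; _≢_)
open import Relation.Nullary using (Dec)

Array : ℕ → ℕ → ℕ → Set
Array N k v = Fin N → Fin k → Fin v

countFin : ∀ {n} {P : Fin n → Set} → (∀ i → Dec (P i)) → ℕ
countFin {n} P? = length (filter P? (allFin n))

occ : ∀ {N k v} → Array N k v → Fin k → Fin v → ℕ
occ C c x = countFin (λ r → C r c FinP.≟ x)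

IsCA : ∀ {N k v} → Array N k v → Set
IsCA {N} {k} {v} C =
  ∀ (c c' : Fin k) → c ≢ c' → ∀ (x y : Fin v) →
  ∃ λ (r : Fin N) → (C r c ≡ x) × (C r c' ≡ y)

ceilDiv : (N v : ℕ) → .{{NonZero v}} → ℕ
ceilDiv N v = (N + (v ∸ 1)) / v

IsUniform : ∀ {N k v} → .{{NonZero v}} → Array N k v → Set
IsUniform {N} {k} {v} C =
  ∀ (c : Fin k) (x : Fin v) → (occ C c x ≡ N / v) ⊎ (occ C c x ≡ ceilDiv N v)

IsUCA : ∀ {N k v} → .{{NonZero v}} → Array N k v → Set
IsUCA C = IsCA C × IsUniform C

numHF : ∀ {N k v} → Array N k v → Fin N → ℕ
numHF {v = v} C r = countFin (λ c → suc v ≤? occ C c (C r c))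

rowsWithHF : ∀ {N k v} → Array N k v → ℕ → ℕ
rowsWithHF C i = countFin (λ r → numHF C r ≟ i)

-- With N = v² + v − 1 rows, every symbol occurs v or v + 1 times in a column, so counting
-- shows that each column c has exactly one symbol ℓ c occurring only v times; an entry is
-- of high frequency iff it differs from ℓ c, and the row r₀ without such entries reads ℓ c
-- in every column c. Another row cannot agree with r₀ in two columns c, c': the v rows
-- carrying ℓ c in column c would have to show all v symbols in column c' and ℓ c' twice.
-- So the v(v + 2) entries of the form ℓ c are at most v + 2 in row r₀ and at most one in
-- each of the other N − 1 rows; as (v + 2) + (N − 1) = v(v + 2), every other row has
-- exactly one such entry, that is, exactly v + 1 high frequency entries.

module Submission where

open import Defs
open import Data.Nat using (ℕ; zero; suc; _+_; _*_; _∸_; _≤_; _<_; _≤?_; z≤n; s≤s; NonZero)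
open import Data.Nat.Properties
open import Data.Nat.DivMod using (_/_; m<n⇒m/n≡0; m*n/n≡m; +-distrib-/-∣ʳ)
open import Data.Nat.Divisibility using (n∣m*n)
open import Data.Nat.Tactic.RingSolver using (solve-∀)
open import Data.Fin using (Fin; zero; suc)
import Data.Fin.Properties as Finₚ
open import Data.List using (List; []; _∷_; length; filter; tabulate)
open import Data.List.Base using (allFin)
open import Data.List.Properties using (filter-some; filter-none)
open import Data.List.Membership.Propositional using (_∈_; lose)
open import Data.List.Membership.Propositional.Properties using (∈-allFin; ∈-filter⁺; ∈-filter⁻)
open import Data.List.Relation.Unary.Any using (here; there)
import Data.List.Relation.Unary.All.Properties as All
open import Data.List.Relation.Unary.All using (_∷_)
open import Data.List.Relation.Unary.AllPairs using (_∷_)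
open import Data.List.Relation.Unary.Unique.Propositional using (Unique)
import Data.List.Relation.Unary.Unique.Propositional.Properties as Unique
open import Algebra.Properties.Semiring.Sum +-*-semiring
  using (sum; sum-syntax; ∑-comm; ∑-distrib-+; sum-cong-≗; *-distribˡ-sum; *-distribʳ-sum)
open import Data.Product using (_×_; _,_; ∃; proj₁; proj₂)
open import Data.Sum as Sum using (_⊎_; inj₁; inj₂)
open import Function using (_∘_; id)
open import Relation.Nullary using (Dec; yes; no; ¬_; contradiction)
open import Relation.Nullary.Decidable using (decidable-stable; _×-dec_)
open import Relation.Binary.PropositionalEquality using (_≡_; _≢_; refl; sym; trans; cong; cong₂; subst; module ≡-Reasoning)

χ : ∀ {p} {P : Set p} → Dec P → ℕ
χ (yes _) = 1
χ (no  _) = 0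

χ-× : ∀ {p q} {P : Set p} {Q : Set q} (P? : Dec P) (Q? : Dec Q) → χ (P? ×-dec Q?) ≡ χ P? * χ Q?
χ-× (yes _) (yes _) = refl
χ-× (yes _) (no  _) = refl
χ-× (no  _) _       = refl

∑-const : ∀ n a → ∑[ i < n ] a ≡ n * a
∑-const zero    a = refl
∑-const (suc n) a = cong (a +_) (∑-const n a)

∑-mono-≤ : ∀ {n} {f g : Fin n → ℕ} → (∀ i → f i ≤ g i) → sum f ≤ sum g
∑-mono-≤ {zero}  f≤g = z≤n
∑-mono-≤ {suc n} f≤g = +-mono-≤ (f≤g zero) (∑-mono-≤ (f≤g ∘ suc))

∑-mono-< : ∀ {n} {f g : Fin n → ℕ} → (∀ i → f i ≤ g i) → ∀ i → f i < g i → sum f < sum g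
∑-mono-< f≤g zero    fi<gi = +-mono-<-≤ fi<gi (∑-mono-≤ (f≤g ∘ suc))
∑-mono-< f≤g (suc i) fi<gi = +-mono-≤-< (f≤g zero) (∑-mono-< (f≤g ∘ suc) i fi<gi)

∑-tight : ∀ {n} {f g : Fin n → ℕ} → (∀ i → f i ≤ g i) → sum g ≤ sum f → ∀ i → f i ≡ g i
∑-tight f≤g ∑g≤∑f i =
  ≤-antisym (f≤g i) (≮⇒≥ λ fi<gi → <⇒≱ (∑-mono-< f≤g i fi<gi) ∑g≤∑f)

module _ {a} {A : Set a} where

  length≤1 : ∀ {xs : List A} → Unique xs → (∀ {x y} → x ∈ xs → y ∈ xs → x ≡ y) → length xs ≤ 1
  length≤1 {[]}        _               _     = z≤n
  length≤1 {_ ∷ []}    _               _     = ≤-refl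
  length≤1 {_ ∷ _ ∷ _} ((x≢y ∷ _) ∷ _) all≡ = contradiction (all≡ (here refl) (there (here refl))) x≢y

  2≤length : ∀ {x y} {xs : List A} → x ≢ y → x ∈ xs → y ∈ xs → 2 ≤ length xs
  2≤length {xs = _ ∷ _ ∷ _} _   _          _          = s≤s (s≤s z≤n)
  2≤length {xs = _ ∷ []}    x≢y (here refl) (here refl) = contradiction refl x≢y

module _ {n} {P : Fin n → Set} (P? : ∀ i → Dec (P i)) where

  countFin-sum : countFin P? ≡ ∑[ i < n ] χ (P? i)
  countFin-sum = count-tabulate (λ i → i)
    where
    count-tabulate : ∀ {m} (g : Fin m → Fin n) →
                     length (filter P? (tabulate g)) ≡ ∑[ j < m ] χ (P? (g j))
    count-tabulate {zero}  g = refl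
    count-tabulate {suc m} g with P? (g zero)
    ... | yes _ = cong suc (count-tabulate (g ∘ suc))
    ... | no  _ = count-tabulate (g ∘ suc)

  countFin-pos : ∀ {i} → P i → 0 < countFin P?
  countFin-pos Pi = filter-some P? (lose (∈-allFin _) Pi)

  countFin-none : (∀ i → ¬ P i) → countFin P? ≡ 0
  countFin-none ¬P = cong length (filter-none P? (All.tabulate⁺ ¬P))

  countFin≤1 : (∀ {i j} → P i → P j → i ≡ j) → countFin P? ≤ 1
  countFin≤1 P-unique = length≤1 (Unique.filter⁺ P? (Unique.allFin⁺ n))
    (λ i∈ j∈ → P-unique (proj₂ (∈-filter⁻ P? {xs = allFin n} i∈))
                        (proj₂ (∈-filter⁻ P? {xs = allFin n} j∈)))

  2≤countFin : ∀ {i j} → i ≢ j → P i → P j → 2 ≤ countFin P?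
  2≤countFin i≢j Pi Pj = 2≤length i≢j (∈-filter⁺ P? (∈-allFin _) Pi) (∈-filter⁺ P? (∈-allFin _) Pj)

  countFin≡1⇒∃! : countFin P? ≡ 1 → ∃ λ i → P i × ∀ {j} → P j → j ≡ i
  countFin≡1⇒∃! count≡1 with Finₚ.any? P?
  ... | yes (i , Pi) = i , Pi , λ {j} Pj → decidable-stable (j Finₚ.≟ i) λ j≢i →
        contradiction (≤-trans (2≤countFin j≢i Pj Pi) (≤-reflexive count≡1)) λ { (s≤s ()) }
  ... | no ∄P = contradiction (trans (sym count≡1) (countFin-none λ i Pi → ∄P (i , Pi))) λ ()

countFin-complement : ∀ {n} {P Q : Fin n → Set} (P? : ∀ i → Dec (P i)) (Q? : ∀ i → Dec (Q i)) →
                      (∀ i → P i → ¬ Q i) → (∀ i → ¬ P i → Q i) →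
                      countFin P? + countFin Q? ≡ n
countFin-complement {n} P? Q? P⇒¬Q ¬P⇒Q = begin
  countFin P? + countFin Q?                 ≡⟨ cong₂ _+_ (countFin-sum P?) (countFin-sum Q?) ⟩
  ∑[ i < n ] χ (P? i) + ∑[ i < n ] χ (Q? i) ≡⟨ ∑-distrib-+ (χ ∘ P?) (χ ∘ Q?) ⟨
  ∑[ i < n ] (χ (P? i) + χ (Q? i))          ≡⟨ sum-cong-≗ exactly-one ⟩
  ∑[ i < n ] 1                              ≡⟨ ∑-const n 1 ⟩
  n * 1                                     ≡⟨ *-identityʳ n ⟩
  n                                         ∎
  where
  open ≡-Reasoning
  exactly-one : ∀ i → χ (P? i) + χ (Q? i) ≡ 1
  exactly-one i with P? i | Q? i
  ... | yes Pi | yes Qi = contradiction Qi (P⇒¬Q i Pi)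
  ... | yes _  | no  _  = refl
  ... | no  _  | yes _  = refl
  ... | no ¬Pi | no ¬Qi = contradiction (¬P⇒Q i ¬Pi) ¬Qi

∑-χ-≡ : ∀ {m} (x : Fin m) → ∑[ y < m ] χ (x Finₚ.≟ y) ≡ 1
∑-χ-≡ x = trans (sym (countFin-sum (x Finₚ.≟_)))
  (≤-antisym (countFin≤1 (x Finₚ.≟_) λ x≡i x≡j → trans (sym x≡i) x≡j) (countFin-pos (x Finₚ.≟_) refl))

∑-fibre-sizes : ∀ {n m} (g : Fin n → Fin m) → ∑[ y < m ] countFin (λ i → g i Finₚ.≟ y) ≡ n
∑-fibre-sizes {n} {m} g = begin
  ∑[ y < m ] countFin (λ i → g i Finₚ.≟ y)    ≡⟨ sum-cong-≗ (λ y → countFin-sum (λ i → g i Finₚ.≟ y)) ⟩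
  ∑[ y < m ] ∑[ i < n ] χ (g i Finₚ.≟ y)      ≡⟨ ∑-comm (λ y i → χ (g i Finₚ.≟ y)) ⟩
  ∑[ i < n ] ∑[ y < m ] χ (g i Finₚ.≟ y)      ≡⟨ sum-cong-≗ (∑-χ-≡ ∘ g) ⟩
  ∑[ i < n ] 1                                ≡⟨ ∑-const n 1 ⟩
  n * 1                                       ≡⟨ *-identityʳ n ⟩
  n                                           ∎
  where open ≡-Reasoning

countFin-fibres : ∀ {n m} {P : Fin n → Set} (P? : ∀ i → Dec (P i)) (g : Fin n → Fin m) →
                  countFin P? ≡ ∑[ y < m ] countFin (λ i → P? i ×-dec (g i Finₚ.≟ y))
countFin-fibres {n} {m} P? g = begin
  countFin P?                                          ≡⟨ countFin-sum P? ⟩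
  ∑[ i < n ] χ (P? i)                                  ≡⟨ sum-cong-≗ (λ i → *-identityʳ (χ (P? i))) ⟨
  ∑[ i < n ] (χ (P? i) * 1)                            ≡⟨ sum-cong-≗ (λ i → cong (χ (P? i) *_) (∑-χ-≡ (g i))) ⟨
  ∑[ i < n ] (χ (P? i) * ∑[ y < m ] δ i y)             ≡⟨ sum-cong-≗ (λ i → *-distribˡ-sum (χ (P? i)) (δ i)) ⟩
  ∑[ i < n ] ∑[ y < m ] (χ (P? i) * δ i y)             ≡⟨ ∑-comm (λ i y → χ (P? i) * δ i y) ⟩
  ∑[ y < m ] ∑[ i < n ] (χ (P? i) * δ i y)             ≡⟨ sum-cong-≗ (λ y → sum-cong-≗ (λ i → χ-× (P? i) (g i Finₚ.≟ y))) ⟨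
  ∑[ y < m ] ∑[ i < n ] χ (P? i ×-dec (g i Finₚ.≟ y))  ≡⟨ sum-cong-≗ (λ y → countFin-sum (λ i → P? i ×-dec (g i Finₚ.≟ y))) ⟨
  ∑[ y < m ] countFin (λ i → P? i ×-dec (g i Finₚ.≟ y)) ∎
  where
  open ≡-Reasoning
  δ : Fin n → Fin m → ℕ
  δ i y = χ (g i Finₚ.≟ y)

countFin-deficient≡1 : ∀ {n a} (f : Fin n → ℕ) → (∀ i → f i ≡ a ⊎ f i ≡ suc a) →
                     suc (sum f) ≡ n * suc a → countFin (λ i → f i ≟ a) ≡ 1
countFin-deficient≡1 {n} {a} f f∈ suc∑f≡ = +-cancelˡ-≡ (sum f) _ _ (begin
  sum f + countFin (λ i → f i ≟ a)        ≡⟨ cong (sum f +_) (countFin-sum (λ i → f i ≟ a)) ⟩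
  sum f + ∑[ i < n ] χ (f i ≟ a)          ≡⟨ ∑-distrib-+ f (λ i → χ (f i ≟ a)) ⟨
  ∑[ i < n ] (f i + χ (f i ≟ a))          ≡⟨ sum-cong-≗ deficit ⟩
  ∑[ i < n ] suc a                        ≡⟨ ∑-const n (suc a) ⟩
  n * suc a                               ≡⟨ suc∑f≡ ⟨
  suc (sum f)                             ≡⟨ +-comm 1 (sum f) ⟩
  sum f + 1                               ∎)
  where
  open ≡-Reasoning
  deficit : ∀ i → f i + χ (f i ≟ a) ≡ suc a
  deficit i with f i ≟ a | f∈ i
  ... | yes fi≡a | _         = trans (+-comm (f i) 1) (cong suc fi≡a)
  ... | no  fi≢a | inj₁ fi≡a = contradiction fi≡a fi≢a
  ... | no  _    | inj₂ fi≡suc = trans (+-identityʳ (f i)) fi≡suc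

module _ {N k v} (C : Array N k v) where

  ∑-occ : ∀ c → ∑[ x < v ] occ C c x ≡ N
  ∑-occ c = ∑-fibre-sizes (λ r → C r c)

  repeatedPair⇒v<occ : IsCA C → ∀ {c c' r r'} → c ≢ c' → r ≢ r' →
                       C r c ≡ C r' c → C r c' ≡ C r' c' → v < occ C c (C r c)
  repeatedPair⇒v<occ covers {c} {c'} {r} {r'} c≢c' r≢r' eq eq' = begin
    suc v                                      ≡⟨ cong suc (*-identityʳ v) ⟨
    1 + v * 1                                  ≡⟨ cong₂ _+_ (∑-χ-≡ z) (∑-const v 1) ⟨
    ∑[ y < v ] χ (z Finₚ.≟ y) + ∑[ y < v ] 1   ≡⟨ ∑-distrib-+ (λ y → χ (z Finₚ.≟ y)) (λ _ → 1) ⟨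
    ∑[ y < v ] (χ (z Finₚ.≟ y) + 1)            ≤⟨ ∑-mono-≤ pairs-lower-bound ⟩
    ∑[ y < v ] pairs y                         ≡⟨ countFin-fibres (λ s → C s c Finₚ.≟ x) (λ s → C s c') ⟨
    occ C c x                                  ∎
    where
    open ≤-Reasoning
    x z : Fin v
    x = C r c
    z = C r c'
    pair? : ∀ y s → Dec (C s c ≡ x × C s c' ≡ y)
    pair? y s = (C s c Finₚ.≟ x) ×-dec (C s c' Finₚ.≟ y)
    pairs : Fin v → ℕ
    pairs y = countFin (pair? y)
    pairs-lower-bound : ∀ y → χ (z Finₚ.≟ y) + 1 ≤ pairs y
    pairs-lower-bound y with z Finₚ.≟ y
    ... | yes refl = 2≤countFin (pair? z) r≢r' (refl , refl) (sym eq , sym eq')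
    ... | no  _    = let (s , Csc≡x , Csc'≡y) = covers c c' c≢c' x y
                     in countFin-pos (pair? y) (Csc≡x , Csc'≡y)

module DeficientSymbol {N k v} (C : Array N k v)
  (occ∈ : ∀ c x → occ C c x ≡ v ⊎ occ C c x ≡ suc v) (suc-N : suc N ≡ v * suc v) where

  private
    deficient : ∀ c → ∃ λ x → occ C c x ≡ v × ∀ {y} → occ C c y ≡ v → y ≡ x
    deficient c = countFin≡1⇒∃! (λ x → occ C c x ≟ v)
      (countFin-deficient≡1 (occ C c) (occ∈ c) (trans (cong suc (∑-occ C c)) suc-N))

  ℓ : Fin k → Fin v
  ℓ c = proj₁ (deficient c)

  occ-ℓ : ∀ c → occ C c (ℓ c) ≡ v
  occ-ℓ c = proj₁ (proj₂ (deficient c))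

  ℓ-unique : ∀ {c x} → occ C c x ≡ v → x ≡ ℓ c
  ℓ-unique {c} = proj₂ (proj₂ (deficient c))

  v<occ⇒≢ℓ : ∀ {c x} → v < occ C c x → x ≢ ℓ c
  v<occ⇒≢ℓ {c} v<occ refl = <-irrefl (sym (occ-ℓ c)) v<occ

  v≮occ⇒≡ℓ : ∀ {c x} → ¬ v < occ C c x → x ≡ ℓ c
  v≮occ⇒≡ℓ {c} {x} v≮occ with occ∈ c x
  ... | inj₁ occ≡v   = ℓ-unique occ≡v
  ... | inj₂ occ≡1+v = contradiction (≤-reflexive (sym occ≡1+v)) v≮occ

module HFFreeRow {N v} (C : Array N (v + 2) v) (covers : IsCA C)
  (occ∈ : ∀ c x → occ C c x ≡ v ⊎ occ C c x ≡ suc v) (suc-N : suc N ≡ v * suc v)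
  {r₀ : Fin N} (r₀-HF-free : numHF C r₀ ≡ 0) where

  open DeficientSymbol C occ∈ suc-N

  HF? : ∀ r c → Dec (v < occ C c (C r c))
  HF? r c = suc v ≤? occ C c (C r c)

  low? : ∀ r c → Dec (C r c ≡ ℓ c)
  low? r c = C r c Finₚ.≟ ℓ c

  low : Fin N → ℕ
  low r = countFin (low? r)

  numHF+low : ∀ r → numHF C r + low r ≡ v + 2
  numHF+low r = countFin-complement (HF? r) (low? r) (λ _ → v<occ⇒≢ℓ) (λ _ → v≮occ⇒≡ℓ)

  ∑-low : ∑[ r < N ] low r ≡ (v + 2) * v
  ∑-low = begin
    ∑[ r < N ] low r                         ≡⟨ sum-cong-≗ (λ r → countFin-sum (low? r)) ⟩
    ∑[ r < N ] ∑[ c < v + 2 ] χ (low? r c)   ≡⟨ ∑-comm (λ r c → χ (low? r c)) ⟩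
    ∑[ c < v + 2 ] ∑[ r < N ] χ (low? r c)   ≡⟨ sum-cong-≗ (λ c → countFin-sum (λ r → low? r c)) ⟨
    ∑[ c < v + 2 ] occ C c (ℓ c)             ≡⟨ sum-cong-≗ occ-ℓ ⟩
    ∑[ c < v + 2 ] v                         ≡⟨ ∑-const (v + 2) v ⟩
    (v + 2) * v                              ∎
    where open ≡-Reasoning

  r₀-low : ∀ c → C r₀ c ≡ ℓ c
  r₀-low c = v≮occ⇒≡ℓ λ v<occ → <⇒≢ (countFin-pos (HF? r₀) v<occ) (sym r₀-HF-free)

  low≤1 : ∀ {r} → r ≢ r₀ → low r ≤ 1
  low≤1 {r} r≢r₀ = countFin≤1 (low? r) λ {c} {c'} low-c low-c' →
    decidable-stable (c Finₚ.≟ c') λ c≢c' →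
      <-irrefl (sym (occ-ℓ c)) (subst (λ x → v < occ C c x) low-c
        (repeatedPair⇒v<occ C covers c≢c' r≢r₀
          (trans low-c (sym (r₀-low c))) (trans low-c' (sym (r₀-low c')))))

  bound : Fin N → ℕ
  bound r = 1 + χ (r₀ Finₚ.≟ r) * suc v

  low≤bound : ∀ r → low r ≤ bound r
  low≤bound r with r₀ Finₚ.≟ r
  ... | yes refl = subst (low r₀ ≤_) (trans (numHF+low r₀) (v+2≡ v)) (m≤n+m (low r₀) (numHF C r₀))
    where
    v+2≡ : ∀ v → v + 2 ≡ 1 + 1 * suc v
    v+2≡ = solve-∀
  ... | no r₀≢r = low≤1 (r₀≢r ∘ sym)

  ∑-bound : ∑[ r < N ] bound r ≡ (v + 2) * v
  ∑-bound = begin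
    ∑[ r < N ] bound r                      ≡⟨ ∑-distrib-+ (λ _ → 1) (λ r → δ r * suc v) ⟩
    ∑[ r < N ] 1 + ∑[ r < N ] (δ r * suc v) ≡⟨ cong₂ _+_ (∑-const N 1) (sym (*-distribʳ-sum (suc v) δ)) ⟩
    N * 1 + (∑[ r < N ] δ r) * suc v        ≡⟨ cong (λ s → N * 1 + s * suc v) (∑-χ-≡ r₀) ⟩
    N * 1 + 1 * suc v                       ≡⟨ cong₂ _+_ (*-identityʳ N) (*-identityˡ (suc v)) ⟩
    N + suc v                               ≡⟨ +-suc N v ⟩
    suc N + v                               ≡⟨ cong (_+ v) suc-N ⟩
    v * suc v + v                           ≡⟨ ring v ⟩
    (v + 2) * v                             ∎
    where
    open ≡-Reasoning
    δ : Fin N → ℕ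
    δ r = χ (r₀ Finₚ.≟ r)
    ring : ∀ v → v * suc v + v ≡ (v + 2) * v
    ring = solve-∀

  numHF≡v+1 : ∀ {r} → r ≢ r₀ → numHF C r ≡ v + 1
  numHF≡v+1 {r} r≢r₀ with r₀ Finₚ.≟ r | ∑-tight low≤bound (≤-reflexive (trans ∑-bound (sym ∑-low))) r
  ... | yes r₀≡r | _      = contradiction (sym r₀≡r) r≢r₀
  ... | no  _    | low≡1 = +-cancelʳ-≡ 1 (numHF C r) (v + 1) (begin
    numHF C r + 1     ≡⟨ cong (numHF C r +_) low≡1 ⟨
    numHF C r + low r ≡⟨ numHF+low r ⟩
    v + 2             ≡⟨ +-assoc v 1 1 ⟨
    v + 1 + 1         ∎)
    where open ≡-Reasoning

  numHF≡0⊎v+1 : ∀ r → numHF C r ≡ 0 ⊎ numHF C r ≡ v + 1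
  numHF≡0⊎v+1 r with r Finₚ.≟ r₀
  ... | yes refl = inj₁ r₀-HF-free
  ... | no r≢r₀  = inj₂ (numHF≡v+1 r≢r₀)

  rowsWithHF[v+1]+rowsWithHF[0]≡N : rowsWithHF C (v + 1) + rowsWithHF C 0 ≡ N
  rowsWithHF[v+1]+rowsWithHF[0]≡N =
    countFin-complement (λ r → numHF C r ≟ v + 1) (λ r → numHF C r ≟ 0)
      (λ r numHF≡v+1 numHF≡0 → 1+n≢0 (trans (+-comm 1 v) (trans (sym numHF≡v+1) numHF≡0)))
      (λ r numHF≢v+1 → Sum.[ id , (λ numHF≡v+1 → contradiction numHF≡v+1 numHF≢v+1) ]
                                    (numHF≡0⊎v+1 r))

  rowsWithHF≡0 : ∀ {i} → i ≢ 0 → i ≢ v + 1 → rowsWithHF C i ≡ 0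
  rowsWithHF≡0 {i} i≢0 i≢v+1 = countFin-none (λ r → numHF C r ≟ i) λ r numHF≡i →
    Sum.[ (λ numHF≡0 → i≢0 (trans (sym numHF≡i) numHF≡0))
        , (λ numHF≡v+1 → i≢v+1 (trans (sym numHF≡i) numHF≡v+1)) ] (numHF≡0⊎v+1 r)

[r+q*n]/n≡q : ∀ r q n .{{_ : NonZero n}} → r < n → (r + q * n) / n ≡ q
[r+q*n]/n≡q r q n r<n = begin
  (r + q * n) / n    ≡⟨ +-distrib-/-∣ʳ r (n∣m*n q) ⟩
  r / n + q * n / n  ≡⟨ cong₂ _+_ (m<n⇒m/n≡0 r<n) (m*n/n≡m q n) ⟩
  q                  ∎
  where open ≡-Reasoning

module UCAParameters (u : ℕ) where
  private
    v N : ℕ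
    v = suc (suc u)
    N = v * v + v ∸ 1

    N≡ : N ≡ suc u + v * v
    N≡ = ring u
      where
      ring : ∀ u → suc u + suc u * suc (suc u) + suc (suc u) ≡ suc u + suc (suc u) * suc (suc u)
      ring = solve-∀

  suc-N : suc N ≡ v * suc v
  suc-N = trans (cong suc N≡) (ring u)
    where
    ring : ∀ u → suc (suc u + suc (suc u) * suc (suc u)) ≡ suc (suc u) * suc (suc (suc u))
    ring = solve-∀

  N/v≡v : N / v ≡ v
  N/v≡v = trans (cong (_/ v) N≡) ([r+q*n]/n≡q (suc u) v v ≤-refl)

  ⌈N/v⌉≡1+v : ceilDiv N v ≡ suc v
  ⌈N/v⌉≡1+v = trans (cong (λ m → (m + suc u) / v) N≡)
    (trans (cong (_/ v) (ring u)) ([r+q*n]/n≡q u (suc v) v (m<n⇒m<1+n (n<1+n u))))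
    where
    ring : ∀ u → suc u + suc (suc u) * suc (suc u) + suc u ≡ u + suc (suc (suc u)) * suc (suc u)
    ring = solve-∀

corollary4 : (v : ℕ) → (2≤v : 2 ≤ v) → .{{_ : NonZero v}} →
    (C : Array (v * v + v ∸ 1) (v + 2) v) → IsUCA C →
    rowsWithHF C 0 ≡ 1 →
    (rowsWithHF C (v + 1) ≡ v * v + v ∸ 2) ×
    (∀ (i : ℕ) → i ≤ v + 2 → i ≢ 0 → i ≢ v + 1 → rowsWithHF C i ≡ 0)
corollary4 v@(suc (suc u)) (s≤s (s≤s z≤n)) C (covers , uniform) a₀≡1 =
  a[v+1] , λ i _ i≢0 i≢v+1 → rowsWithHF≡0 i≢0 i≢v+1
  where
  open UCAParameters u
  occ∈ : ∀ c x → occ C c x ≡ v ⊎ occ C c x ≡ suc v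
  occ∈ c x = Sum.map (λ occ≡ → trans occ≡ N/v≡v) (λ occ≡ → trans occ≡ ⌈N/v⌉≡1+v) (uniform c x)
  HF-free-row : ∃ λ r₀ → numHF C r₀ ≡ 0 × ∀ {r} → numHF C r ≡ 0 → r ≡ r₀
  HF-free-row = countFin≡1⇒∃! (λ r → numHF C r ≟ 0) a₀≡1
  open HFFreeRow C covers occ∈ suc-N (proj₁ (proj₂ HF-free-row))
  a[v+1] : rowsWithHF C (v + 1) ≡ v * v + v ∸ 2
  a[v+1] = begin
    rowsWithHF C (v + 1)                      ≡⟨ m+n∸n≡m (rowsWithHF C (v + 1)) 1 ⟨
    rowsWithHF C (v + 1) + 1 ∸ 1              ≡⟨ cong (λ a₀ → rowsWithHF C (v + 1) + a₀ ∸ 1) a₀≡1 ⟨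
    rowsWithHF C (v + 1) + rowsWithHF C 0 ∸ 1 ≡⟨ cong (_∸ 1) rowsWithHF[v+1]+rowsWithHF[0]≡N ⟩
    v * v + v ∸ 1 ∸ 1                         ≡⟨ ∸-+-assoc (v * v + v) 1 1 ⟩
    v * v + v ∸ 2                             ∎
    where open ≡-Reasoning
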